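{- Let $K\leq\mathrm{Aut}(Q_n)$ and $\Pi:=(Q_n)_K$. The following are equivalent: (i) the natural map $\pi:Q_n\to\Pi$, $x\mapsto x^K$, is a covering; (ii) $\Pi$ is regular of valency $n$; (iii) $d_K\geq 3$.
   Context: The $n$-cube $Q_n$ has vertex set $\mathbb{F}_2^n$, two vectors adjacent iff their Hamming distance is $1$; $\mathrm{Aut}(Q_n)=\mathbb{F}_2^n: S_n$. For $K\leq\mathrm{Aut}(Q_n)$, $d_K:=\min\{d_{Q_n}(x,x^k): x\in\mathbb{F}_2^n,\ 1\neq k\in K\}$ if $K\neq 1$ and $d_K:=\infty$ if $K=1$. The normal quotient $(Q_n)_K$ is the simple graph whose vertices are the $K$-orbits $x^K$, distinct orbits adjacent iff some vertex of one is adjacent in $Q_n$ to some vertex of the other. A surjective map $\pi:\Gamma\to\Pi$ between graphs is a covering if for every vertex $x$ of $\Gamma$, $\pi$ induces a bijection from the neighbourhood $\Gamma(x)$ onto $\Pi(x\pi)$. -}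

module Defs where

open import Data.Nat using (ℕ; zero; suc; _+_; _≤_)
open import Data.Bool using (Bool; true; false; _xor_)
open import Data.Fin using (Fin)
open import Data.Fin.Permutation using (Permutation′; _⟨$⟩ʳ_; _⟨$⟩ˡ_)
open import Data.Vec using (Vec; []; _∷_; lookup; tabulate)
open import Data.Product using (Σ; ∃; ∃₂; _×_)
open import Relation.Nullary using (¬_)
open import Relation.Binary.PropositionalEquality using (_≡_)

Vertex : ℕ → Set
Vertex n = Vec Bool n

hamming : ∀ {n} → Vertex n → Vertex n → ℕ
hamming []       []       = 0
hamming (a ∷ x) (b ∷ y) = (if′ (a xor b)) + hamming x y
  where
  if′ : Bool → ℕ
  if′ true  = 1
  if′ false = 0

Adj : ∀ {n} → Vertex n → Vertex n → Set
Adj x y = hamming x y ≡ 1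

-- An element of Aut(Q_n) = F_2^n : S_n : a coordinate permutation followed by a translation
record Aut (n : ℕ) : Set where
  field
    perm  : Permutation′ n
    shift : Vec Bool n
open Aut public

act : ∀ {n} → Aut n → Vertex n → Vertex n
act g x = tabulate (λ i → lookup x (perm g ⟨$⟩ˡ i) xor lookup (shift g) i)

IsId : ∀ {n} → Aut n → Set
IsId {n} g = (∀ (i : Fin n) → perm g ⟨$⟩ʳ i ≡ i) × (∀ (i : Fin n) → lookup (shift g) i ≡ false)

record IsSubgroup {n : ℕ} (K : Aut n → Set) : Set₁ where
  field
    has-id  : ∃ λ e → K e × IsId e
    closed· : ∀ g h → K g → K h → ∃ λ k → K k × (∀ x → act k x ≡ act h (act g x))
    closed⁻ : ∀ g → K g → ∃ λ k → K k × (∀ x → act k (act g x) ≡ x)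

-- x and y lie in the same K-orbit (i.e. represent the same vertex of (Q_n)_K)
SameOrbit : ∀ {n} → (Aut n → Set) → Vertex n → Vertex n → Set
SameOrbit K x y = ∃ λ k → K k × act k x ≡ y

AdjΠ : ∀ {n} → (Aut n → Set) → Vertex n → Vertex n → Set
AdjΠ K x y = ¬ SameOrbit K x y ×
  ∃₂ λ x' y' → SameOrbit K x x' × SameOrbit K y y' × Adj x' y'

-- (i) x ↦ x^K is a covering Q_n → (Q_n)_K : for every x it maps Q_n(x) bijectively onto Π(x^K)
IsCovering : ∀ {n} → (Aut n → Set) → Set
IsCovering {n} K = ∀ (x : Vertex n) →
  (∀ y → Adj x y → AdjΠ K x y) ×
  (∀ y z → Adj x y → Adj x z → SameOrbit K y z → y ≡ z) ×
  (∀ w → AdjΠ K x w → ∃ λ y → Adj x y × SameOrbit K y w)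

-- (ii) (Q_n)_K is regular of valency m : each orbit x^K has exactly m neighbouring orbits,
-- i.e. there is a bijection Fin m → Π(x^K) (orbits given by representatives)
IsRegularOfValency : ∀ {n} → (Aut n → Set) → ℕ → Set
IsRegularOfValency {n} K m = ∀ (x : Vertex n) →
  Σ (Fin m → Vertex n) λ f →
    (∀ i → AdjΠ K x (f i)) ×
    (∀ i j → SameOrbit K (f i) (f j) → i ≡ j) ×
    (∀ w → AdjΠ K x w → ∃ λ i → SameOrbit K (f i) w)

-- m ≤ d_K, where d_K = min { d(x, x^k) : x, 1 ≠ k ∈ K } (= ∞ if K = 1)
dK≥ : ∀ {n} → (Aut n → Set) → ℕ → Set
dK≥ {n} K m = ∀ (x : Vertex n) (k : Aut n) → K k → ¬ IsId k → m ≤ hamming x (act k x)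

-- An automorphism of Q_n maps the neighbours of x bijectively onto the neighbours of x^g, and
-- every edge of the quotient lifts to an edge at any chosen preimage. So x ↦ x^K is a covering
-- iff the n neighbours of each x lie in n distinct orbits, none of them the orbit of x. A
-- non-identity k ∈ K with d(x, x^k) = 1 puts a neighbour in the orbit of x; with d(x, x^k) = 2
-- it identifies two neighbours of a common neighbour of x and x^k; and d(x, x^k) = 0 is
-- impossible under the covering condition, since an automorphism fixing a vertex and all its
-- neighbours is the identity. Regularity of valency n is equivalent to the covering condition
-- because lifting the n quotient neighbours of x^K gives n neighbours of x in distinct flip
-- directions, hence all of them.
module Submission where

open import Defs
open import Data.Nat using (ℕ; suc; _≤_; z≤n; s≤s)
open import Data.Nat.Properties using (≤-refl; ≤-trans; m≤n+m; suc-injective; 0≢1+n; 1+n≰n)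
open import Data.Bool using (true; false; not; _xor_)
open import Data.Bool.Properties using (xor-identityʳ; not-distribˡ-xor)
  renaming (_≟_ to _≟ᵇ_)
open import Data.Fin using (Fin; punchOut; _≟_)
import Data.Fin as Fin
open import Data.Fin.Properties using (all?; any?; injective⇒≤; punchOut-injective)
open import Data.Fin.Permutation using (_⟨$⟩ʳ_; _⟨$⟩ˡ_; inverseˡ; inverseʳ)
open import Data.Vec using ([]; _∷_; lookup)
open import Data.Vec.Properties using (lookup∘tabulate; ∷-injective)
open import Data.Vec.Relation.Binary.Pointwise.Extensional using (ext; Pointwise-≡⇒≡)
open import Data.Product using (_×_; _,_; proj₁; proj₂; ∃)
open import Data.Sum using (_⊎_; inj₁; inj₂)
open import Data.Empty using (⊥-elim)
open import Function using (_∘_; case_of_)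
open import Function.Bundles using (_⇔_; mk⇔)
open import Function.Definitions using (Injective)
open import Relation.Nullary using (¬_; Dec; yes; no)
open import Relation.Nullary.Decidable using (_×-dec_)
open import Relation.Binary.PropositionalEquality

flip : ∀ {n} → Vertex n → Fin n → Vertex n
flip (a ∷ x) Fin.zero    = not a ∷ x
flip (a ∷ x) (Fin.suc i) = a ∷ flip x i

lookup∘flip : ∀ {n} (x : Vertex n) i → lookup (flip x i) i ≡ not (lookup x i)
lookup∘flip (a ∷ x) Fin.zero    = refl
lookup∘flip (a ∷ x) (Fin.suc i) = lookup∘flip x i

lookup∘flip′ : ∀ {n} (x : Vertex n) {i j} → j ≢ i → lookup (flip x i) j ≡ lookup x j
lookup∘flip′ (a ∷ x) {Fin.zero}  {Fin.zero}  j≢i = ⊥-elim (j≢i refl)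
lookup∘flip′ (a ∷ x) {Fin.zero}  {Fin.suc j} j≢i = refl
lookup∘flip′ (a ∷ x) {Fin.suc i} {Fin.zero}  j≢i = refl
lookup∘flip′ (a ∷ x) {Fin.suc i} {Fin.suc j} j≢i = lookup∘flip′ x (j≢i ∘ cong Fin.suc)

flip-injective : ∀ {n} (x : Vertex n) {i j} → flip x i ≡ flip x j → i ≡ j
flip-injective (a ∷ x)     {Fin.zero}  {Fin.zero}  _  = refl
flip-injective (false ∷ x) {Fin.zero}  {Fin.suc j} ()
flip-injective (true ∷ x)  {Fin.zero}  {Fin.suc j} ()
flip-injective (false ∷ x) {Fin.suc i} {Fin.zero}  ()
flip-injective (true ∷ x)  {Fin.suc i} {Fin.zero}  ()
flip-injective (a ∷ x)     {Fin.suc i} {Fin.suc j} eq =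
  cong Fin.suc (flip-injective x (proj₂ (∷-injective eq)))

hamming-refl : ∀ {n} (x : Vertex n) → hamming x x ≡ 0
hamming-refl []          = refl
hamming-refl (false ∷ x) = hamming-refl x
hamming-refl (true ∷ x)  = hamming-refl x

hamming≡0⇒≡ : ∀ {n} (x y : Vertex n) → hamming x y ≡ 0 → x ≡ y
hamming≡0⇒≡ []          []          _  = refl
hamming≡0⇒≡ (false ∷ x) (false ∷ y) eq = cong (false ∷_) (hamming≡0⇒≡ x y eq)
hamming≡0⇒≡ (true ∷ x)  (true ∷ y)  eq = cong (true ∷_) (hamming≡0⇒≡ x y eq)
hamming≡0⇒≡ (false ∷ x) (true ∷ y)  ()
hamming≡0⇒≡ (true ∷ x)  (false ∷ y) ()

hamming-sym : ∀ {n} (x y : Vertex n) → hamming x y ≡ hamming y x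
hamming-sym []          []          = refl
hamming-sym (false ∷ x) (false ∷ y) = hamming-sym x y
hamming-sym (false ∷ x) (true ∷ y)  = cong suc (hamming-sym x y)
hamming-sym (true ∷ x)  (false ∷ y) = cong suc (hamming-sym x y)
hamming-sym (true ∷ x)  (true ∷ y)  = hamming-sym x y

hamming-flip-≤ : ∀ {n} (x y : Vertex n) i → hamming (flip x i) y ≤ suc (hamming x y)
hamming-flip-≤ (false ∷ x) (false ∷ y) Fin.zero    = ≤-refl
hamming-flip-≤ (false ∷ x) (true ∷ y)  Fin.zero    = m≤n+m _ 2
hamming-flip-≤ (true ∷ x)  (false ∷ y) Fin.zero    = m≤n+m _ 2
hamming-flip-≤ (true ∷ x)  (true ∷ y)  Fin.zero    = ≤-refl
hamming-flip-≤ (false ∷ x) (false ∷ y) (Fin.suc i) = hamming-flip-≤ x y i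
hamming-flip-≤ (false ∷ x) (true ∷ y)  (Fin.suc i) = s≤s (hamming-flip-≤ x y i)
hamming-flip-≤ (true ∷ x)  (false ∷ y) (Fin.suc i) = s≤s (hamming-flip-≤ x y i)
hamming-flip-≤ (true ∷ x)  (true ∷ y)  (Fin.suc i) = hamming-flip-≤ x y i

hamming≡1+m⇒flip : ∀ {n} (x y : Vertex n) m → hamming x y ≡ suc m →
                   ∃ λ i → hamming (flip x i) y ≡ m
hamming≡1+m⇒flip []          []          m ()
hamming≡1+m⇒flip (false ∷ x) (true ∷ y)  m eq = Fin.zero , suc-injective eq
hamming≡1+m⇒flip (true ∷ x)  (false ∷ y) m eq = Fin.zero , suc-injective eq
hamming≡1+m⇒flip (false ∷ x) (false ∷ y) m eq =
  let i , d = hamming≡1+m⇒flip x y m eq in Fin.suc i , d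
hamming≡1+m⇒flip (true ∷ x)  (true ∷ y)  m eq =
  let i , d = hamming≡1+m⇒flip x y m eq in Fin.suc i , d

Adj-flip : ∀ {n} (x : Vertex n) i → Adj x (flip x i)
Adj-flip (false ∷ x) Fin.zero    = cong suc (hamming-refl x)
Adj-flip (true ∷ x)  Fin.zero    = cong suc (hamming-refl x)
Adj-flip (false ∷ x) (Fin.suc i) = Adj-flip x i
Adj-flip (true ∷ x)  (Fin.suc i) = Adj-flip x i

Adj⇒flip : ∀ {n} (x y : Vertex n) → Adj x y → ∃ λ i → y ≡ flip x i
Adj⇒flip x y adj =
  let i , d = hamming≡1+m⇒flip x y 0 adj in i , sym (hamming≡0⇒≡ _ _ d)

Adj-sym : ∀ {n} (x y : Vertex n) → Adj x y → Adj y x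
Adj-sym x y adj = trans (hamming-sym y x) adj

Adj-Adj⇒hamming≤2 : ∀ {n} (x y z : Vertex n) → Adj x y → Adj x z → hamming y z ≤ 2
Adj-Adj⇒hamming≤2 x y z x—y x—z with Adj⇒flip x y x—y | Adj⇒flip x z x—z
... | i , refl | j , refl =
  subst (λ m → hamming (flip x i) (flip x j) ≤ suc m) (Adj-flip x j) (hamming-flip-≤ x (flip x j) i)

lookup-act : ∀ {n} (g : Aut n) x i → lookup (act g x) i ≡ lookup x (perm g ⟨$⟩ˡ i) xor lookup (shift g) i
lookup-act g x i = lookup∘tabulate _ i

perm⁻¹-fixed : ∀ {n} (g : Aut n) → (∀ i → perm g ⟨$⟩ʳ i ≡ i) → ∀ i → perm g ⟨$⟩ˡ i ≡ i
perm⁻¹-fixed g fixed i = trans (cong (perm g ⟨$⟩ˡ_) (sym (fixed i))) (inverseˡ (perm g))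

act-IsId : ∀ {n} (g : Aut n) → IsId g → ∀ x → act g x ≡ x
act-IsId g (perm-fixed , shift-false) x = Pointwise-≡⇒≡ (ext λ i → begin
  lookup (act g x) i                                ≡⟨ lookup-act g x i ⟩
  lookup x (perm g ⟨$⟩ˡ i) xor lookup (shift g) i   ≡⟨ cong₂ (λ j b → lookup x j xor b)
                                                         (perm⁻¹-fixed g perm-fixed i) (shift-false i) ⟩
  lookup x i xor false                              ≡⟨ xor-identityʳ _ ⟩
  lookup x i                                        ∎)
  where open ≡-Reasoning

act-flip : ∀ {n} (g : Aut n) x i → act g (flip x i) ≡ flip (act g x) (perm g ⟨$⟩ʳ i)
act-flip g x i = Pointwise-≡⇒≡ (ext λ j → lookup-act-flip j (j ≟ perm g ⟨$⟩ʳ i))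
  where
  open ≡-Reasoning
  σ = perm g
  s = lookup (shift g)
  lookup-act-flip : ∀ j → Dec (j ≡ σ ⟨$⟩ʳ i) →
                    lookup (act g (flip x i)) j ≡ lookup (flip (act g x) (σ ⟨$⟩ʳ i)) j
  lookup-act-flip j (yes refl) = begin
    lookup (act g (flip x i)) j                ≡⟨ lookup-act g (flip x i) j ⟩
    lookup (flip x i) (σ ⟨$⟩ˡ j) xor s j       ≡⟨ cong (λ k → lookup (flip x i) k xor s j) (inverseˡ σ) ⟩
    lookup (flip x i) i xor s j                ≡⟨ cong (_xor s j) (lookup∘flip x i) ⟩
    not (lookup x i) xor s j                   ≡⟨ not-distribˡ-xor (lookup x i) (s j) ⟨
    not (lookup x i xor s j)                   ≡⟨ cong (λ k → not (lookup x k xor s j)) (inverseˡ σ) ⟨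
    not (lookup x (σ ⟨$⟩ˡ j) xor s j)          ≡⟨ cong not (lookup-act g x j) ⟨
    not (lookup (act g x) j)                   ≡⟨ lookup∘flip (act g x) j ⟨
    lookup (flip (act g x) j) j                ∎
  lookup-act-flip j (no j≢σi) = begin
    lookup (act g (flip x i)) j                ≡⟨ lookup-act g (flip x i) j ⟩
    lookup (flip x i) (σ ⟨$⟩ˡ j) xor s j       ≡⟨ cong (_xor s j) (lookup∘flip′ x σ⁻¹j≢i) ⟩
    lookup x (σ ⟨$⟩ˡ j) xor s j                ≡⟨ lookup-act g x j ⟨
    lookup (act g x) j                         ≡⟨ lookup∘flip′ (act g x) j≢σi ⟨
    lookup (flip (act g x) (σ ⟨$⟩ʳ i)) j       ∎
    where
    σ⁻¹j≢i : σ ⟨$⟩ˡ j ≢ i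
    σ⁻¹j≢i eq = j≢σi (trans (sym (inverseʳ σ)) (cong (σ ⟨$⟩ʳ_) eq))

x-xor-y≡x⇒y≡false : ∀ x y → x xor y ≡ x → y ≡ false
x-xor-y≡x⇒y≡false false false _ = refl
x-xor-y≡x⇒y≡false true  false _ = refl
x-xor-y≡x⇒y≡false false true  ()
x-xor-y≡x⇒y≡false true  true  ()

fixes-closedNeighbourhood⇒IsId : ∀ {n} (g : Aut n) x → act g x ≡ x →
                                 (∀ i → act g (flip x i) ≡ flip x i) → IsId g
fixes-closedNeighbourhood⇒IsId g x gx≡x fixes-flips = perm-fixed , shift-false
  where
  perm-fixed : ∀ i → perm g ⟨$⟩ʳ i ≡ i
  perm-fixed i = flip-injective x (begin
    flip x (perm g ⟨$⟩ʳ i)         ≡⟨ cong (λ y → flip y (perm g ⟨$⟩ʳ i)) gx≡x ⟨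
    flip (act g x) (perm g ⟨$⟩ʳ i) ≡⟨ act-flip g x i ⟨
    act g (flip x i)               ≡⟨ fixes-flips i ⟩
    flip x i                       ∎)
    where open ≡-Reasoning
  shift-false : ∀ i → lookup (shift g) i ≡ false
  shift-false i = x-xor-y≡x⇒y≡false (lookup x i) (lookup (shift g) i) (begin
    lookup x i xor lookup (shift g) i                ≡⟨ cong (λ j → lookup x j xor lookup (shift g) i)
                                                          (perm⁻¹-fixed g perm-fixed i) ⟨
    lookup x (perm g ⟨$⟩ˡ i) xor lookup (shift g) i  ≡⟨ lookup-act g x i ⟨
    lookup (act g x) i                               ≡⟨ cong (λ y → lookup y i) gx≡x ⟩
    lookup x i                                       ∎)
    where open ≡-Reasoning

isId? : ∀ {n} (g : Aut n) → Dec (IsId g)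
isId? g = all? (λ i → perm g ⟨$⟩ʳ i ≟ i) ×-dec all? (λ i → lookup (shift g) i ≟ᵇ false)

injective⇒surjective : ∀ {n} {f : Fin n → Fin n} → Injective _≡_ _≡_ f → ∀ j → ∃ λ i → f i ≡ j
injective⇒surjective {suc n} {f} f-inj j with any? (λ i → f i ≟ j)
... | yes hit = hit
... | no miss = ⊥-elim (1+n≰n (injective⇒≤ {f = f-avoiding-j} f-avoiding-j-injective))
  where
  f-avoiding-j : Fin (suc n) → Fin n
  f-avoiding-j i = punchOut {i = j} {j = f i} (λ j≡fi → miss (i , sym j≡fi))
  f-avoiding-j-injective : Injective _≡_ _≡_ f-avoiding-j
  f-avoiding-j-injective {x} {y} eq = f-inj (punchOut-injective {i = j} {f x} {f y} _ _ eq)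

module _ {n} {K : Aut n → Set} (K≤ : IsSubgroup K) where
  open IsSubgroup K≤

  SameOrbit-refl : ∀ x → SameOrbit K x x
  SameOrbit-refl x = let e , e∈K , e≡1 = has-id in e , e∈K , act-IsId e e≡1 x

  SameOrbit-sym : ∀ x y → SameOrbit K x y → SameOrbit K y x
  SameOrbit-sym x _ (k , k∈K , refl) = let k⁻¹ , k⁻¹∈K , k⁻¹k≡1 = closed⁻ k k∈K in k⁻¹ , k⁻¹∈K , k⁻¹k≡1 x

  SameOrbit-trans : ∀ x y z → SameOrbit K x y → SameOrbit K y z → SameOrbit K x z
  SameOrbit-trans x _ _ (k , k∈K , refl) (h , h∈K , refl) =
    let kh , kh∈K , kh≡h∘k = closed· k h k∈K h∈K in kh , kh∈K , kh≡h∘k x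

  AdjΠ-respʳ : ∀ x w w′ → AdjΠ K x w → SameOrbit K w w′ → AdjΠ K x w′
  AdjΠ-respʳ x w w′ (x≁w , x′ , y′ , x~x′ , w~y′ , x′—y′) w~w′ =
    (λ x~w′ → x≁w (SameOrbit-trans x w′ w x~w′ w′~w)) ,
    x′ , y′ , x~x′ , SameOrbit-trans w′ w y′ w′~w w~y′ , x′—y′
    where
    w′~w = SameOrbit-sym w w′ w~w′

  AdjΠ⇒lift : ∀ x w → AdjΠ K x w → ∃ λ y → Adj x y × SameOrbit K y w
  AdjΠ⇒lift x w (_ , _ , y′ , (k , k∈K , refl) , w~y′ , kx—y′)
    with i , refl ← Adj⇒flip (act k x) y′ kx—y′
       | k⁻¹ , k⁻¹∈K , k⁻¹k≡1 ← closed⁻ k k∈K =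
    flip x j , Adj-flip x j ,
    SameOrbit-sym w (flip x j) (SameOrbit-trans w y′ (flip x j) w~y′ (k⁻¹ , k⁻¹∈K , k⁻¹y′≡flip))
    where
    j = perm k⁻¹ ⟨$⟩ʳ i
    k⁻¹y′≡flip : act k⁻¹ (flip (act k x) i) ≡ flip x j
    k⁻¹y′≡flip = trans (act-flip k⁻¹ (act k x) i) (cong (λ v → flip v j) (k⁻¹k≡1 x))

  SameOrbit⇒≡⊎far : ∀ {m} x y → dK≥ K m → SameOrbit K x y → x ≡ y ⊎ m ≤ hamming x y
  SameOrbit⇒≡⊎far x _ dK (k , k∈K , refl) with isId? k
  ... | yes k≡1 = inj₁ (sym (act-IsId k k≡1 x))
  ... | no  k≢1 = inj₂ (dK x k k∈K k≢1)

  dK≥3⇒IsCovering : dK≥ K 3 → IsCovering K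
  dK≥3⇒IsCovering dK x = Adj⇒AdjΠ , Adj-orbit-injective , AdjΠ⇒lift x
    where
    Adj⇒AdjΠ : ∀ y → Adj x y → AdjΠ K x y
    Adj⇒AdjΠ y x—y = x≁y , x , y , SameOrbit-refl x , SameOrbit-refl y , x—y
      where
      x≁y : ¬ SameOrbit K x y
      x≁y x~y with SameOrbit⇒≡⊎far x y dK x~y
      ... | inj₁ refl = 0≢1+n (trans (sym (hamming-refl x)) x—y)
      ... | inj₂ 3≤d  = case subst (3 ≤_) x—y 3≤d of λ { (s≤s ()) }
    Adj-orbit-injective : ∀ y z → Adj x y → Adj x z → SameOrbit K y z → y ≡ z
    Adj-orbit-injective y z x—y x—z y~z with SameOrbit⇒≡⊎far y z dK y~z
    ... | inj₁ y≡z = y≡z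
    ... | inj₂ 3≤d = ⊥-elim (1+n≰n (≤-trans 3≤d (Adj-Adj⇒hamming≤2 x y z x—y x—z)))

  IsCovering⇒dK≥3 : IsCovering K → dK≥ K 3
  IsCovering⇒dK≥3 cov x k k∈K k≢1 with hamming x (act k x) in d≡
  ... | 0 = ⊥-elim (k≢1 (fixes-closedNeighbourhood⇒IsId k x kx≡x fixes-flips))
    where
    kx≡x : act k x ≡ x
    kx≡x = sym (hamming≡0⇒≡ x (act k x) d≡)
    x—kxj : ∀ j → Adj x (act k (flip x j))
    x—kxj j = subst (Adj x) (sym (trans (act-flip k x j) (cong (λ v → flip v (perm k ⟨$⟩ʳ j)) kx≡x)))
                (Adj-flip x (perm k ⟨$⟩ʳ j))
    fixes-flips : ∀ j → act k (flip x j) ≡ flip x j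
    fixes-flips j = sym (proj₁ (proj₂ (cov x)) (flip x j) (act k (flip x j)) (Adj-flip x j) (x—kxj j)
                      (k , k∈K , refl))
  ... | 1 = ⊥-elim (proj₁ (proj₁ (cov x) (act k x) d≡) (k , k∈K , refl))
  ... | 2 = ⊥-elim (0≢1+n (trans (sym (hamming-refl x)) (trans (cong (hamming x) x≡kx) d≡)))
    where
    -- x and x^k have a common neighbour, in whose neighbourhood they are identified.
    i = proj₁ (hamming≡1+m⇒flip x (act k x) 1 d≡)
    x≡kx : x ≡ act k x
    x≡kx = proj₁ (proj₂ (cov (flip x i))) x (act k x) (Adj-sym x (flip x i) (Adj-flip x i))
             (proj₂ (hamming≡1+m⇒flip x (act k x) 1 d≡)) (k , k∈K , refl)
  ... | suc (suc (suc _)) = s≤s (s≤s (s≤s z≤n))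

  IsCovering⇒IsRegularOfValency : IsCovering K → IsRegularOfValency K n
  IsCovering⇒IsRegularOfValency cov x =
    flip x ,
    (λ i → proj₁ (cov x) (flip x i) (Adj-flip x i)) ,
    (λ i j o → flip-injective x (proj₁ (proj₂ (cov x)) (flip x i) (flip x j) (Adj-flip x i) (Adj-flip x j) o)) ,
    AdjΠ⇒flip-orbit
    where
    AdjΠ⇒flip-orbit : ∀ w → AdjΠ K x w → ∃ λ i → SameOrbit K (flip x i) w
    AdjΠ⇒flip-orbit w x—w with y , x—y , y~w ← AdjΠ⇒lift x w x—w
                       with i , refl ← Adj⇒flip x y x—y = i , y~w

  IsRegularOfValency⇒IsCovering : IsRegularOfValency K n → IsCovering K
  IsRegularOfValency⇒IsCovering reg x with f , x—f , f-injective , _ ← reg x =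
    Adj⇒AdjΠ , Adj-orbit-injective , AdjΠ⇒lift x
    where
    lift : Fin n → Vertex n
    lift i = proj₁ (AdjΠ⇒lift x (f i) (x—f i))
    x—lift : ∀ i → Adj x (lift i)
    x—lift i = proj₁ (proj₂ (AdjΠ⇒lift x (f i) (x—f i)))
    lift~f : ∀ i → SameOrbit K (lift i) (f i)
    lift~f i = proj₂ (proj₂ (AdjΠ⇒lift x (f i) (x—f i)))
    lift-orbit-injective : ∀ i j → SameOrbit K (lift i) (lift j) → i ≡ j
    lift-orbit-injective i j li~lj = f-injective i j
      (SameOrbit-trans (f i) (lift i) (f j) (SameOrbit-sym (lift i) (f i) (lift~f i))
        (SameOrbit-trans (lift i) (lift j) (f j) li~lj (lift~f j)))
    direction : Fin n → Fin n
    direction i = proj₁ (Adj⇒flip x (lift i) (x—lift i))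
    lift≡flip : ∀ i → lift i ≡ flip x (direction i)
    lift≡flip i = proj₂ (Adj⇒flip x (lift i) (x—lift i))
    direction-injective : Injective _≡_ _≡_ direction
    direction-injective {i} {j} eq = lift-orbit-injective i j
      (subst (SameOrbit K (lift i)) (trans (lift≡flip i) (trans (cong (flip x) eq) (sym (lift≡flip j))))
        (SameOrbit-refl (lift i)))
    Adj⇒lift : ∀ y → Adj x y → ∃ λ i → y ≡ lift i
    Adj⇒lift y x—y with t , refl ← Adj⇒flip x y x—y
                   with i , refl ← injective⇒surjective direction-injective t = i , sym (lift≡flip i)
    Adj⇒AdjΠ : ∀ y → Adj x y → AdjΠ K x y
    Adj⇒AdjΠ y x—y with i , refl ← Adj⇒lift y x—y =
      AdjΠ-respʳ x (f i) (lift i) (x—f i) (SameOrbit-sym (lift i) (f i) (lift~f i))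
    Adj-orbit-injective : ∀ y z → Adj x y → Adj x z → SameOrbit K y z → y ≡ z
    Adj-orbit-injective y z x—y x—z y~z with i , refl ← Adj⇒lift y x—y | j , refl ← Adj⇒lift z x—z
      = cong lift (lift-orbit-injective i j y~z)

lemma3p5 : (n : ℕ) (K : Aut n → Set) → IsSubgroup K →
    (IsCovering K ⇔ IsRegularOfValency K n) × (IsRegularOfValency K n ⇔ dK≥ K 3)
lemma3p5 n K K≤ =
  mk⇔ (IsCovering⇒IsRegularOfValency K≤) (IsRegularOfValency⇒IsCovering K≤) ,
  mk⇔ (IsCovering⇒dK≥3 K≤ ∘ IsRegularOfValency⇒IsCovering K≤)
      (IsCovering⇒IsRegularOfValency K≤ ∘ dK≥3⇒IsCovering K≤)
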